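{- Let $vs$ be a list of variables and $\mathcal Q$ a relation with $vs\Vdash\mathcal Q$. (i) For every command $c$ with $vs\Vdash c$, we have $vs\Vdash\mathrm{wlpR}(c,\mathcal Q)$. (ii) For every bicom $B$ with $vs\Vdash B$, we have $vs\Vdash\mathrm{wlp}(B,\mathcal Q)$.
   Context: Stores are total functions from (integer and boolean) variables to values of the appropriate type; relations are subsets of $\mathsf{Store}\times\mathsf{Store}$. Commands $c$ (skip, assignment, havoc, assert of a store set, sequence, if, while; expressions arbitrary functions on stores) have a big-step semantics $c/s\Downarrow\phi$ with $\phi$ a store or $\mathsf{fail}$. Bicoms $B$ (embeds $\langle c|c'\rangle$, relational asserts, havoc-filters $\mathsf{havf}\ x\ \mathcal P$, sequence, four-way bi-if, bi-while with alignment conditions) have a big-step semantics $B/(s,s')\Downarrow\varphi$ with $\varphi$ a pair of stores or $\mathsf{fail}$; in particular $\langle\mathsf{skip}|c\rangle/(s,s')\Downarrow\mathsf{fail}$ iff $c/s'\Downarrow\mathsf{fail}$, and $\langle\mathsf{skip}|c\rangle/(s,s')\Downarrow(s,t')$ iff $c/s'\Downarrow t'$. $\mathrm{wlp}(B,\mathcal Q)=\{(s,s'):$ not $B/(s,s')\Downarrow\mathsf{fail}$, and $(t,t')\in\mathcal Q$ whenever $B/(s,s')\Downarrow(t,t')\}$; $\mathrm{wlpR}(c,\mathcal Q)=\mathrm{wlp}(\langle\mathsf{skip}|c\rangle,\mathcal Q)$. For a list $vs$ of variables, $s=_{vs}t$ iff $s(x)=t(x)$ for all $x\in vs$. $vs\Vdash\mathcal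 R$ iff for all $s,t,s',t'$ with $s=_{vs}t$ and $s'=_{vs}t'$: $(s,s')\in\mathcal R\iff(t,t')\in\mathcal R$. $vs\Vdash c$ iff (for all $s,s',t$: $s=_{vs}s'$ and $c/s\Downarrow t$ imply there is $t'$ with $c/s'\Downarrow t'$ and $t=_{vs}t'$) and (for all $s,s'$: $s=_{vs}s'$ and $c/s\Downarrow\mathsf{fail}$ imply $c/s'\Downarrow\mathsf{fail}$). $vs\Vdash B$ iff (for all $s,s',t,t',u,u'$: $s=_{vs}t$, $s'=_{vs}t'$ and $B/(s,s')\Downarrow(u,u')$ imply there are $v,v'$ with $B/(t,t')\Downarrow(v,v')$, $u=_{vs}v$, $u'=_{vs}v'$) and (for all $s,s',t,t'$: $s=_{vs}t$, $s'=_{vs}t'$ and $B/(s,s')\Downarrow\mathsf{fail}$ imply $B/(t,t')\Downarrow\mathsf{fail}$). -}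

module Defs where

open import Data.Nat using (ℕ)
open import Data.Nat.Properties using (_≟_)
open import Data.Integer using (ℤ)
open import Data.Bool using (Bool; true; false)
open import Data.List using (List)
open import Data.List.Membership.Propositional using (_∈_)
open import Data.Product using (_×_; _,_; ∃)
open import Relation.Nullary using (¬_; yes; no)
open import Relation.Binary.PropositionalEquality using (_≡_)
open import Level using (Level; suc; zero)

data Var : Set where
  ivar : ℕ → Var
  bvar : ℕ → Var

Val : Var → Set
Val (ivar _) = ℤ
Val (bvar _) = Bool

Store : Set
Store = (x : Var) → Val x

upd : Store → (x : Var) → Val x → Store
upd s (ivar n) v (ivar m) with n ≟ m
... | yes _ = v
... | no  _ = s (ivar m)
upd s (bvar n) v (bvar m) with n ≟ m
... | yes _ = v
... | no  _ = s (bvar m)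
upd s (ivar _) _ (bvar m) = s (bvar m)
upd s (bvar _) _ (ivar m) = s (ivar m)

StorePred : Set₁
StorePred = Store → Set

Rel : (ℓ : Level) → Set (suc ℓ)
Rel ℓ = Store → Store → Set ℓ

data Out (A : Set) : Set where
  ok   : A → Out A
  fail : Out A

infixr 5 _⨾_
data Cmd : Set₁ where
  skip   : Cmd
  assign : (x : Var) → (Store → Val x) → Cmd
  havoc  : Var → Cmd
  assert : StorePred → Cmd
  _⨾_    : Cmd → Cmd → Cmd
  if     : (Store → Bool) → Cmd → Cmd → Cmd
  while  : (Store → Bool) → Cmd → Cmd

data _/_⇓_ : Cmd → Store → Out Store → Set₁ where
  e-skip    : ∀ {s} → skip / s ⇓ ok s
  e-assign  : ∀ {s x e} → assign x e / s ⇓ ok (upd s x (e s))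
  e-havoc   : ∀ {s x} (v : Val x) → havoc x / s ⇓ ok (upd s x v)
  e-assert  : ∀ {s P} → P s → assert P / s ⇓ ok s
  e-assertF : ∀ {s P} → ¬ P s → assert P / s ⇓ fail
  e-seq     : ∀ {c₁ c₂ s t φ} → c₁ / s ⇓ ok t → c₂ / t ⇓ φ → (c₁ ⨾ c₂) / s ⇓ φ
  e-seqF    : ∀ {c₁ c₂ s} → c₁ / s ⇓ fail → (c₁ ⨾ c₂) / s ⇓ fail
  e-ifT     : ∀ {b c₁ c₂ s φ} → b s ≡ true → c₁ / s ⇓ φ → if b c₁ c₂ / s ⇓ φ
  e-ifF     : ∀ {b c₁ c₂ s φ} → b s ≡ false → c₂ / s ⇓ φ → if b c₁ c₂ / s ⇓ φ
  e-whileF  : ∀ {b c s} → b s ≡ false → while b c / s ⇓ ok s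
  e-whileT  : ∀ {b c s t φ} → b s ≡ true → c / s ⇓ ok t →
              while b c / t ⇓ φ → while b c / s ⇓ φ
  e-whileTF : ∀ {b c s} → b s ≡ true → c / s ⇓ fail → while b c / s ⇓ fail

data Bicom : Set₁ where
  ⟨_∣_⟩   : Cmd → Cmd → Bicom
  bassert : Rel zero → Bicom
  -- havf x P : havoc the right-hand copy of x, filtered by P
  havf    : Var → Rel zero → Bicom
  _⨾⨾_    : Bicom → Bicom → Bicom
  -- four-way bi-if: branches for (true,true) (true,false) (false,true) (false,false)
  bif     : (Store → Bool) → (Store → Bool) → Bicom → Bicom → Bicom → Bicom → Bicom
  -- bi-while  while b | b' . P | P' do B  with bodies for the joint,
  -- left-only and right-only iterations
  bwhile  : (Store → Bool) → (Store → Bool) → Rel zero → Rel zero →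
            (joint left right : Bicom) → Bicom

data _/_⇓b_ : Bicom → Store × Store → Out (Store × Store) → Set₁ where
  b-emb    : ∀ {c c' s s' t t'} → c / s ⇓ ok t → c' / s' ⇓ ok t' →
             ⟨ c ∣ c' ⟩ / (s , s') ⇓b ok (t , t')
  b-embFL  : ∀ {c c' s s'} → c / s ⇓ fail → ⟨ c ∣ c' ⟩ / (s , s') ⇓b fail
  b-embFR  : ∀ {c c' s s' t} → c / s ⇓ ok t → c' / s' ⇓ fail →
             ⟨ c ∣ c' ⟩ / (s , s') ⇓b fail
  b-assert : ∀ {R s s'} → R s s' → bassert R / (s , s') ⇓b ok (s , s')
  b-assertF : ∀ {R s s'} → ¬ R s s' → bassert R / (s , s') ⇓b fail
  b-havf   : ∀ {x P s s'} (v : Val x) → P s (upd s' x v) →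
             havf x P / (s , s') ⇓b ok (s , upd s' x v)
  b-havfF  : ∀ {x P s s'} → (∀ (v : Val x) → ¬ P s (upd s' x v)) →
             havf x P / (s , s') ⇓b fail
  b-seq    : ∀ {B₁ B₂ σ τ φ} → B₁ / σ ⇓b ok τ → B₂ / τ ⇓b φ → (B₁ ⨾⨾ B₂) / σ ⇓b φ
  b-seqF   : ∀ {B₁ B₂ σ} → B₁ / σ ⇓b fail → (B₁ ⨾⨾ B₂) / σ ⇓b fail
  b-ifTT   : ∀ {b b' B₁ B₂ B₃ B₄ s s' φ} → b s ≡ true → b' s' ≡ true →
             B₁ / (s , s') ⇓b φ → bif b b' B₁ B₂ B₃ B₄ / (s , s') ⇓b φ
  b-ifTF   : ∀ {b b' B₁ B₂ B₃ B₄ s s' φ} → b s ≡ true → b' s' ≡ false →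
             B₂ / (s , s') ⇓b φ → bif b b' B₁ B₂ B₃ B₄ / (s , s') ⇓b φ
  b-ifFT   : ∀ {b b' B₁ B₂ B₃ B₄ s s' φ} → b s ≡ false → b' s' ≡ true →
             B₃ / (s , s') ⇓b φ → bif b b' B₁ B₂ B₃ B₄ / (s , s') ⇓b φ
  b-ifFF   : ∀ {b b' B₁ B₂ B₃ B₄ s s' φ} → b s ≡ false → b' s' ≡ false →
             B₄ / (s , s') ⇓b φ → bif b b' B₁ B₂ B₃ B₄ / (s , s') ⇓b φ
  b-wDone  : ∀ {b b' P P' B Bl Br s s'} → b s ≡ false → b' s' ≡ false →
             bwhile b b' P P' B Bl Br / (s , s') ⇓b ok (s , s')
  b-wLeft  : ∀ {b b' P P' B Bl Br s s' φ} → b s ≡ true → P s s' →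
             (Bl ⨾⨾ bwhile b b' P P' B Bl Br) / (s , s') ⇓b φ →
             bwhile b b' P P' B Bl Br / (s , s') ⇓b φ
  b-wRight : ∀ {b b' P P' B Bl Br s s' φ} → ¬ (b s ≡ true × P s s') →
             b' s' ≡ true → P' s s' →
             (Br ⨾⨾ bwhile b b' P P' B Bl Br) / (s , s') ⇓b φ →
             bwhile b b' P P' B Bl Br / (s , s') ⇓b φ
  b-wJoint : ∀ {b b' P P' B Bl Br s s' φ} → b s ≡ true → b' s' ≡ true →
             ¬ P s s' → ¬ P' s s' →
             (B ⨾⨾ bwhile b b' P P' B Bl Br) / (s , s') ⇓b φ →
             bwhile b b' P P' B Bl Br / (s , s') ⇓b φ
  b-wFailL : ∀ {b b' P P' B Bl Br s s'} → b s ≡ true → b' s' ≡ false →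
             ¬ P s s' → bwhile b b' P P' B Bl Br / (s , s') ⇓b fail
  b-wFailR : ∀ {b b' P P' B Bl Br s s'} → b s ≡ false → b' s' ≡ true →
             ¬ P' s s' → bwhile b b' P P' B Bl Br / (s , s') ⇓b fail

wlp : ∀ {ℓ} → Bicom → Rel ℓ → Rel (suc zero Level.⊔ ℓ)
wlp B Q s s' = ¬ (B / (s , s') ⇓b fail)
             × (∀ t t' → B / (s , s') ⇓b ok (t , t') → Q t t')

wlpR : ∀ {ℓ} → Cmd → Rel ℓ → Rel (suc zero Level.⊔ ℓ)
wlpR c Q = wlp ⟨ skip ∣ c ⟩ Q

_=[_]_ : Store → List Var → Store → Set
s =[ vs ] t = ∀ x → x ∈ vs → s x ≡ t x

_⊩R_ : ∀ {ℓ} → List Var → Rel ℓ → Set ℓ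
vs ⊩R R = ∀ s t s' t' → s =[ vs ] t → s' =[ vs ] t' →
          (R s s' → R t t') × (R t t' → R s s')

_⊩c_ : List Var → Cmd → Set₁
vs ⊩c c = (∀ s s' t → s =[ vs ] s' → c / s ⇓ ok t →
             ∃ λ t' → (c / s' ⇓ ok t') × (t =[ vs ] t'))
        × (∀ s s' → s =[ vs ] s' → c / s ⇓ fail → c / s' ⇓ fail)

_⊩b_ : List Var → Bicom → Set₁
vs ⊩b B = (∀ s s' t t' u u' → s =[ vs ] t → s' =[ vs ] t' →
             B / (s , s') ⇓b ok (u , u') →
             ∃ λ v → ∃ λ v' → (B / (t , t') ⇓b ok (v , v')) × (u =[ vs ] v) × (u' =[ vs ] v'))
        × (∀ s s' t t' → s =[ vs ] t → s' =[ vs ] t' →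
             B / (s , s') ⇓b fail → B / (t , t') ⇓b fail)

module Submission where

open import Defs
open import Data.List using (List)
open import Data.Product using (_×_; _,_; ∃; proj₂)
open import Level using (Level; zero)
open import Relation.Binary.PropositionalEquality using (sym)

-- Independence of wlp B Q is inherited from that of B and Q: a run (or failure) of B
-- from one pair of states is matched by one from any vs-equivalent pair, and Q cannot
-- distinguish the vs-equivalent final states. Part (i) is part (ii) for ⟨ skip ∣ c ⟩.

=[]-sym : ∀ {vs s t} → s =[ vs ] t → t =[ vs ] s
=[]-sym s=t x x∈vs = sym (s=t x x∈vs)

⊩c-skip : ∀ vs → vs ⊩c skip
⊩c-skip vs = (λ { s s' .s s=s' e-skip → s' , e-skip , s=s' }) , λ { s s' s=s' () }

⊩c-embed : ∀ {vs c c'} → vs ⊩c c → vs ⊩c c' → vs ⊩b ⟨ c ∣ c' ⟩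
⊩c-embed {vs} {c} {c'} (c-ok , c-fail) (c'-ok , c'-fail) = embed-ok , embed-fail
  where
  embed-ok : ∀ s s' t t' u u' → s =[ vs ] t → s' =[ vs ] t' →
             ⟨ c ∣ c' ⟩ / (s , s') ⇓b ok (u , u') →
             ∃ λ v → ∃ λ v' →
               (⟨ c ∣ c' ⟩ / (t , t') ⇓b ok (v , v')) × (u =[ vs ] v) × (u' =[ vs ] v')
  embed-ok s s' t t' u u' s=t s'=t' (b-emb run run') =
    let v , run-t , u=v = c-ok s t u s=t run
        v' , run-t' , u'=v' = c'-ok s' t' u' s'=t' run'
    in v , v' , b-emb run-t run-t' , u=v , u'=v'

  embed-fail : ∀ s s' t t' → s =[ vs ] t → s' =[ vs ] t' →
               ⟨ c ∣ c' ⟩ / (s , s') ⇓b fail → ⟨ c ∣ c' ⟩ / (t , t') ⇓b fail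
  embed-fail s s' t t' s=t s'=t' (b-embFL fails) = b-embFL (c-fail s t s=t fails)
  embed-fail s s' t t' s=t s'=t' (b-embFR run fails') =
    let _ , run-t , _ = c-ok s t _ s=t run
    in b-embFR run-t (c'-fail s' t' s'=t' fails')

wlp-transport : ∀ {ℓ : Level} {vs} {Q : Rel ℓ} B → vs ⊩R Q → vs ⊩b B →
                ∀ {s t s' t'} → s =[ vs ] t → s' =[ vs ] t' → wlp B Q s s' → wlp B Q t t'
wlp-transport B ⊩Q (B-ok , B-fail) {s} {t} {s'} {t'} s=t s'=t' (no-fail , post) =
  (λ fails → no-fail (B-fail t t' s s' (=[]-sym s=t) (=[]-sym s'=t') fails)) ,
  λ u u' run →
    let v , v' , run-s , u=v , u'=v' = B-ok t t' s s' u u' (=[]-sym s=t) (=[]-sym s'=t') run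
    in proj₂ (⊩Q u v u' v' u=v u'=v') (post v v' run-s)

⊩R-wlp : ∀ {ℓ : Level} {vs} {Q : Rel ℓ} B → vs ⊩R Q → vs ⊩b B → vs ⊩R wlp B Q
⊩R-wlp B ⊩Q ⊩B s t s' t' s=t s'=t' =
  wlp-transport B ⊩Q ⊩B s=t s'=t' ,
  wlp-transport B ⊩Q ⊩B (=[]-sym s=t) (=[]-sym s'=t')

lemma4p13 : (vs : List Var) (Q : Rel zero) → vs ⊩R Q →
    (∀ (c : Cmd) → vs ⊩c c → vs ⊩R wlpR c Q)
    × (∀ (B : Bicom) → vs ⊩b B → vs ⊩R wlp B Q)
lemma4p13 vs Q ⊩Q =
  (λ c ⊩c → ⊩R-wlp ⟨ skip ∣ c ⟩ ⊩Q (⊩c-embed (⊩c-skip vs) ⊩c)) ,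
  (λ B ⊩B → ⊩R-wlp B ⊩Q ⊩B)
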